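{- (Knowledge gain) Let $\mathcal C=\langle V_{\mathcal C},S_{\mathcal C},\chi_{\mathcal C},W_{\mathcal C},\ell_{\mathcal C}\rangle$ and $\mathcal D=\langle V_{\mathcal D},S_{\mathcal D},\chi_{\mathcal D},W_{\mathcal D},\ell_{\mathcal D}\rangle$ be simplicial models with vertex labellings, and let $f:\mathcal C\to\mathcal D$ be a morphism. Let $\varphi$ be a guarded positive epistemic formula. Then for every world $X\in W_{\mathcal C}$, $\mathcal D,f(X)\models\varphi$ implies $\mathcal C,X\models\varphi$.
   Context: Fix a finite set $A$ of agents and a set $\mathsf{AP}=\bigcup_{a\in A}\mathsf{AP}_a$ of atomic propositions partitioned by agent; for $B\subseteq A$ write $\mathsf{AP}_B=\bigcup_{b\in B}\mathsf{AP}_b$. A chromatic simplicial complex is $\langle V,S,\chi\rangle$ with $S$ a family of non-empty subsets of $V$ containing all singletons and closed under non-empty subsets, and $\chi:V\to A$ injective on each simplex. A simplicial model (with vertex labelling) is $\langle V,S,\chi,W,\ell\rangle$ with $\langle V,S,\chi\rangle$ a chromatic simplicial complex, a set of worlds $W$ with $\mathrm{Facets}\subseteq W\subseteq S$ (facets = maximal simplices), and $\ell$ assigning to each vertex $v$ a set $\ell(v)\subseteq\mathsf{AP}_{\chi(v)}$; a world $w$ is labelled by $\ell(w)=\bigcup_{v\in w}\ell(v)$. A morphism $f$ from $\langle V_1,S_1,\chi_1,W_1,\ell_1\rangle$ to $\langle V_2,S_2,\chi_2,W_2,\ell_2\rangle$ is a map $f:V_1\to V_2$ sending simplices to simplices,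 with $f(X)\in W_2$ for every $X\in W_1$, $\chi_2(f(v))=\chi_1(v)$ and $\ell_2(f(v))=\ell_1(v)$ for all $v\in V_1$. Satisfaction at a world $w$ of $\mathcal M=\langle V,S,\chi,W,\ell\rangle$: $p$ iff $p\in\ell(w)$; $\neg,\wedge,\vee$ standard; $D_U\varphi$ iff $\varphi$ holds at every $w'\in W$ with $U\subseteq\chi(w\cap w')$; $C_U\varphi$ (common knowledge) iff $\varphi$ holds at every $w'\in W$ reachable from $w$ by a finite sequence $w=w_0,w_1,\dots,w_k=w'$ of worlds ($k\ge0$) such that for each $i$ some $u\in U$ satisfies $u\in\chi(w_i\cap w_{i+1})$. Here $U$ ranges over non-empty subsets of $A$. For $a\in A$, $\mathsf{alive}(a)$ holds at $w$ iff $a\in\chi(w)$ (it abbreviates $\neg D_{\{a\}}\bot$), and $\mathsf{alive}(B):=\bigwedge_{a\in B}\mathsf{alive}(a)$. Guarded positive epistemic formulas: $\varphi::=(\mathsf{alive}(B)\Rightarrow\psi_B)\mid\varphi\wedge\varphi\mid\varphi\vee\varphi\mid D_U\varphi\mid C_U\varphi$ with $U,B\subseteq A$ and $\psi_B$ a propositional formula $\psi_B::=p\mid\neg\psi_B\mid\psi_B\wedge\psi_B$ with $p\in\mathsf{AP}_B$. -}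

module Defs where

open import Level using (0ℓ; Lift; suc)
open import Data.Nat using (ℕ)
open import Data.Fin using (Fin)
open import Data.Fin.Subset using (Subset; Nonempty) renaming (_∈_ to _∈ₛ_)
open import Data.Product using (Σ; ∃; _×_; _,_)
open import Data.Sum using (_⊎_)
open import Relation.Nullary using (¬_)
open import Relation.Unary using (Pred; _⊆_; Satisfiable; _∈_)
open import Relation.Binary.PropositionalEquality using (_≡_)

-- Agents: A = Fin nA.  Atomic propositions: a type AP together with
-- owner : AP → Fin nA, so that AP_a = { p | owner p ≡ a }.
module Epistemic (nA : ℕ) (AP : Set) (owner : AP → Fin nA) where

  Agent : Set
  Agent = Fin nA

  IsFacet : {V : Set} → (Pred V 0ℓ → Set) → Pred V 0ℓ → Set₁
  IsFacet S X = S X × (∀ Y → S Y → X ⊆ Y → Y ⊆ X)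

  record Model : Set₁ where
    field
      V    : Set
      S    : Pred V 0ℓ → Set
      χ    : V → Agent
      W    : Pred V 0ℓ → Set
      ℓ    : V → Pred AP 0ℓ
      S-nonempty  : ∀ X → S X → Satisfiable X
      S-singleton : ∀ v → S (v ≡_)
      S-down      : ∀ X Y → S X → Y ⊆ X → Satisfiable Y → S Y
      χ-inj : ∀ X → S X → ∀ {u v} → u ∈ X → v ∈ X → χ u ≡ χ v → u ≡ v
      W⊆S      : ∀ X → W X → S X
      Facet⊆W  : ∀ X → IsFacet S X → W X
      ℓ-owner : ∀ v p → p ∈ ℓ v → owner p ≡ χ v

    colours : Pred V 0ℓ → Pred Agent 0ℓ
    colours X a = ∃ λ v → v ∈ X × χ v ≡ a

    sharedColours : Pred V 0ℓ → Pred V 0ℓ → Pred Agent 0ℓ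
    sharedColours X Y a = ∃ λ v → v ∈ X × v ∈ Y × χ v ≡ a

    label : Pred V 0ℓ → Pred AP 0ℓ
    label X p = ∃ λ v → v ∈ X × p ∈ ℓ v

  image : {V₁ V₂ : Set} → (V₁ → V₂) → Pred V₁ 0ℓ → Pred V₂ 0ℓ
  image f X w = ∃ λ v → v ∈ X × f v ≡ w

  record Morphism (M N : Model) : Set₁ where
    field
      map     : Model.V M → Model.V N
      simp    : ∀ X → Model.S M X → Model.S N (image map X)
      world   : ∀ X → Model.W M X → Model.W N (image map X)
      colour  : ∀ v → Model.χ N (map v) ≡ Model.χ M v
      labelTo   : ∀ v p → p ∈ Model.ℓ N (map v) → p ∈ Model.ℓ M v
      labelFrom : ∀ v p → p ∈ Model.ℓ M v → p ∈ Model.ℓ N (map v)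

  data PForm (B : Subset nA) : Set where
    atom : (p : AP) → owner p ∈ₛ B → PForm B
    neg  : PForm B → PForm B
    conj : PForm B → PForm B → PForm B

  data GForm : Set where
    guard : (B : Subset nA) → PForm B → GForm
    conj  : GForm → GForm → GForm
    disj  : GForm → GForm → GForm
    D     : (U : Subset nA) → Nonempty U → GForm → GForm
    C     : (U : Subset nA) → Nonempty U → GForm → GForm

  module _ (M : Model) where
    open Model M

    psat : ∀ {B} → Pred V 0ℓ → PForm B → Set
    psat w (atom p _) = p ∈ label w
    psat w (neg ψ)    = ¬ psat w ψ
    psat w (conj ψ θ) = psat w ψ × psat w θ

    alive : Subset nA → Pred V 0ℓ → Set
    alive B w = ∀ a → a ∈ₛ B → a ∈ colours w

    data Reach (U : Subset nA) : Pred V 0ℓ → Pred V 0ℓ → Set₁ where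
      here : ∀ {w} → Reach U w w
      step : ∀ {w w₁ w'} → W w₁ →
             (∃ λ u → u ∈ₛ U × u ∈ sharedColours w w₁) →
             Reach U w₁ w' → Reach U w w'

    sat : Pred V 0ℓ → GForm → Set₁
    sat w (guard B ψ) = Lift (suc 0ℓ) (alive B w → psat w ψ)
    sat w (conj φ θ)  = sat w φ × sat w θ
    sat w (disj φ θ)  = sat w φ ⊎ sat w θ
    sat w (D U _ φ)   = ∀ w' → W w' → (∀ a → a ∈ₛ U → a ∈ sharedColours w w') → sat w' φ
    sat w (C U _ φ)   = ∀ w' → W w' → Reach U w w' → sat w' φ

{-# OPTIONS --safe #-}
module Submission where

open import Defs
open import Data.Nat using (ℕ)
open import Data.Fin using (Fin)
open import Data.Fin.Subset using (Subset)
open import Data.Product using (_,_)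
open import Data.Sum using (inj₁; inj₂)
open import Level using (lift; lower)
open import Relation.Unary using (Pred; _∈_; _⊆_)
open import Relation.Binary.PropositionalEquality using (refl; trans)

-- A morphism preserves vertex labels exactly, so the propositional part of a guard
-- (the only place where negation occurs) has the same truth value at X and f(X).
-- Everything else is positive: f maps colours, shared colours and worlds forward, so
-- alive(B) and every D_U / C_U alternative of X has a counterpart at f(X).  Hence guards
-- and box modalities are reflected, and the truth of φ at f(X) descends to X.
-- The argument works for any set of vertices X.
module _ (nA : ℕ) (AP : Set) (owner : AP → Fin nA) where
  open Epistemic nA AP owner

  psat-resp-label : ∀ {M N : Model} {X : Pred (Model.V M) _} {Y : Pred (Model.V N) _}
    {B : Subset nA} → Model.label M X ⊆ Model.label N Y → Model.label N Y ⊆ Model.label M X →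
    (ψ : PForm B) → psat M X ψ → psat N Y ψ
  psat-resp-label X⊆Y Y⊆X (atom p _) h       = X⊆Y h
  psat-resp-label X⊆Y Y⊆X (neg ψ)    h h'    = h (psat-resp-label Y⊆X X⊆Y ψ h')
  psat-resp-label X⊆Y Y⊆X (conj ψ θ) (h , k) =
    psat-resp-label X⊆Y Y⊆X ψ h , psat-resp-label X⊆Y Y⊆X θ k

  module _ {𝒞 𝒟 : Model} (f : Morphism 𝒞 𝒟) where
    open Morphism f
    private
      module C = Model 𝒞
      module D = Model 𝒟

    label-image⁺ : ∀ X → C.label X ⊆ D.label (image map X)
    label-image⁺ X (v , v∈X , p∈ℓv) = map v , (v , v∈X , refl) , labelFrom v _ p∈ℓv

    label-image⁻ : ∀ X → D.label (image map X) ⊆ C.label X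
    label-image⁻ X (_ , (v , v∈X , refl) , p∈ℓfv) = v , v∈X , labelTo v _ p∈ℓfv

    colours-image : ∀ X → C.colours X ⊆ D.colours (image map X)
    colours-image X (v , v∈X , χv≡a) = map v , (v , v∈X , refl) , trans (colour v) χv≡a

    sharedColours-image : ∀ X Y → C.sharedColours X Y ⊆ D.sharedColours (image map X) (image map Y)
    sharedColours-image X Y (v , v∈X , v∈Y , χv≡a) =
      map v , (v , v∈X , refl) , (v , v∈Y , refl) , trans (colour v) χv≡a

    Reach-image : ∀ {U X Y} → Reach 𝒞 U X Y → Reach 𝒟 U (image map X) (image map Y)
    Reach-image here = here
    Reach-image (step {w = X} {w₁ = Z} Z∈W (u , u∈U , u∈XZ) Z↝Y) =
      step (world Z Z∈W) (u , u∈U , sharedColours-image X Z u∈XZ) (Reach-image Z↝Y)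

    sat-reflect : ∀ (φ : GForm) X → sat 𝒟 (image map X) φ → sat 𝒞 X φ
    sat-reflect (guard B ψ) X h = lift λ B-alive →
      psat-resp-label (label-image⁻ X) (label-image⁺ X) ψ
        (lower h λ a a∈B → colours-image X (B-alive a a∈B))
    sat-reflect (conj φ θ) X (h , k) = sat-reflect φ X h , sat-reflect θ X k
    sat-reflect (disj φ θ) X (inj₁ h) = inj₁ (sat-reflect φ X h)
    sat-reflect (disj φ θ) X (inj₂ h) = inj₂ (sat-reflect θ X h)
    sat-reflect (D U _ φ) X h Y Y∈W U⊆XY =
      sat-reflect φ Y (h (image map Y) (world Y Y∈W) λ a a∈U → sharedColours-image X Y (U⊆XY a a∈U))
    sat-reflect (C U _ φ) X h Y Y∈W X↝Y =
      sat-reflect φ Y (h (image map Y) (world Y Y∈W) (Reach-image X↝Y))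

theorem59 : (nA : ℕ) (AP : Set) (owner : AP → Fin nA) →
    let open Epistemic nA AP owner in
    (𝒞 𝒟 : Model) (f : Morphism 𝒞 𝒟) (φ : GForm) →
    ∀ X → X ∈ Model.W 𝒞 →
    sat 𝒟 (image (Morphism.map f) X) φ → sat 𝒞 X φ
theorem59 nA AP owner 𝒞 𝒟 f φ X _ = sat-reflect nA AP owner f φ X
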